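{- Let $G$ be a finite simple graph of maximum degree at most $3$, and let $\{A,B\}$ be a nice partition of $V(G)$ such that every connected component of the induced subgraph $G[B]$ has at most one edge. If a vertex $v\in A$ has at most one neighbor in $B$, then $v$ is unstable, i.e. $\{A\setminus\{v\},B\cup\{v\}\}$ is also a nice partition of $V(G)$.
   Context: A partition $\{A,B\}$ of $V(G)$ is nice if each of the induced subgraphs $G[A]$ and $G[B]$ is a disjoint union of paths of length at most $2$ (at most two edges each). -}

module Defs where

open import Data.Nat using (ℕ; zero; suc; _≤_)
open import Data.Fin using (Fin; _≟_)
open import Data.Bool using (Bool; true; false; not; _∧_; if_then_else_)
open import Data.List using (List; []; _∷_; length; filterᵇ; allFin; concat; all)
open import Data.List.Membership.Propositional using (_∈_)
open import Data.List.Relation.Unary.Any using (Any)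
open import Data.List.Relation.Unary.All using (All)
open import Data.List.Relation.Unary.Unique.Propositional using (Unique)
open import Data.Product using (Σ; _×_; _,_; ∃)
open import Data.Sum using (_⊎_)
open import Relation.Binary.PropositionalEquality using (_≡_)
open import Relation.Nullary.Decidable using (⌊_⌋)
open import Function.Bundles using (_⇔_)

record SimpleGraph (n : ℕ) : Set where
  field
    adj    : Fin n → Fin n → Bool
    sym    : ∀ u v → adj u v ≡ adj v u
    irrefl : ∀ u → adj u u ≡ false
open SimpleGraph public

degree : ∀ {n} → SimpleGraph n → Fin n → ℕ
degree {n} G v = length (filterᵇ (adj G v) (allFin n))

MaxDegreeAtMost : ∀ {n} → SimpleGraph n → ℕ → Set
MaxDegreeAtMost G d = ∀ v → degree G v ≤ d

VSet : ℕ → Set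
VSet n = Fin n → Bool

data Consec {n : ℕ} (u v : Fin n) : List (Fin n) → Set where
  here-fw : ∀ {rest} → Consec u v (u ∷ v ∷ rest)
  here-bw : ∀ {rest} → Consec u v (v ∷ u ∷ rest)
  there   : ∀ {x rest} → Consec u v rest → Consec u v (x ∷ rest)

-- a path of length at most 2, given by its vertex sequence: 1, 2 or 3 vertices
ShortPathSeq : ∀ {n} → List (Fin n) → Set
ShortPathSeq p = 1 ≤ length p × length p ≤ 3

-- G[S] is a disjoint union of paths of length at most 2 (at most two edges):
-- there is a family of vertex sequences, each with 1..3 vertices, which together
-- list every vertex of S exactly once, and such that for u, v ∈ S, u and v are
-- adjacent in G iff they are consecutive on one of these paths.
-- (Distinctness of the vertices inside each sequence is part of Unique (concat Ps).)
DisjointUnionShortPaths : ∀ {n} → SimpleGraph n → VSet n → Set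
DisjointUnionShortPaths {n} G S =
  Σ (List (List (Fin n))) λ Ps →
    All ShortPathSeq Ps
    × Unique (concat Ps)
    × (∀ v → (v ∈ concat Ps) ⇔ (S v ≡ true))
    × (∀ u v → S u ≡ true → S v ≡ true →
         (adj G u v ≡ true) ⇔ Any (Consec u v) Ps)

-- A partition {A,B} of V(G) is encoded by side : Fin n → Bool
-- (side v ≡ true means v ∈ A, side v ≡ false means v ∈ B).
inA inB : ∀ {n} → VSet n → VSet n
inA side = side
inB side v = not (side v)

Nice : ∀ {n} → SimpleGraph n → VSet n → Set
Nice G side = DisjointUnionShortPaths G (inA side) × DisjointUnionShortPaths G (inB side)

data Reach {n : ℕ} (G : SimpleGraph n) (S : VSet n) : Fin n → Fin n → Set where
  refl-r : ∀ {u} → Reach G S u u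
  step   : ∀ {u v w} → adj G u v ≡ true → S v ≡ true → Reach G S v w → Reach G S u w

-- every connected component of G[S] has at most one edge: any two edges of G[S]
-- lying in the same component coincide.
ComponentsAtMostOneEdge : ∀ {n} → SimpleGraph n → VSet n → Set
ComponentsAtMostOneEdge G S =
  ∀ a b c d → S a ≡ true → S b ≡ true → S c ≡ true → S d ≡ true →
  adj G a b ≡ true → adj G c d ≡ true → Reach G S a c →
  (a ≡ c × b ≡ d) ⊎ (a ≡ d × b ≡ c)

neighboursIn : ∀ {n} → SimpleGraph n → VSet n → Fin n → ℕ
neighboursIn {n} G S v = length (filterᵇ (λ u → adj G v u ∧ S u) (allFin n))

moveToB : ∀ {n} → VSet n → Fin n → VSet n
moveToB side v u = if ⌊ u ≟ v ⌋ then false else side u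

-- Moving v from A to B deletes v from its path in G[A], splitting that path into at most two
-- shorter ones. In B, v has either no neighbour, and then forms a one-vertex path on its own, or
-- exactly one neighbour w. The component of w in G[B] has at most one edge, so it is a path on at
-- most two vertices with w as an end, and appending v there gives a path with at most two edges.
module Submission where

open import Defs
open import Data.Bool using (Bool; true; false; not; _∧_; T?)
open import Data.Bool.Properties using (T-≡; not-¬)
open import Data.Empty using (⊥-elim)
open import Data.Fin using (Fin; _≟_)
open import Data.List using (List; []; _∷_; _++_; [_]; length; concat; filterᵇ; allFin)
open import Data.List.Properties using (concat-++; ++-identityʳ; length-++)
open import Data.List.Membership.Propositional using (_∈_; _∉_; lose)
open import Data.List.Membership.Propositional.Properties
  using (∈-++⁺ˡ; ∈-++⁺ʳ; ∈-concat⁺′; ∈-concat⁻′; ∈-∃++; ∈-filter⁺; ∈-filter⁻; ∈-allFin)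
open import Data.List.Relation.Binary.Disjoint.Propositional using (Disjoint)
open import Data.List.Relation.Unary.All as All using (All; []; _∷_)
open import Data.List.Relation.Unary.All.Properties as All using (¬Any⇒All¬)
open import Data.List.Relation.Unary.Any as Any using (Any; here; there)
open import Data.List.Relation.Unary.Any.Properties as Any using (¬Any[])
open import Data.List.Relation.Unary.Unique.Propositional using (Unique; []; _∷_)
import Data.List.Relation.Unary.Unique.Propositional.Properties as Unique
open import Data.Nat using (ℕ; _+_; _≤_; z≤n; s≤s)
open import Data.Nat.Properties using (≤-trans; ≤-reflexive; m≤m+n; m≤n+m; n≤1+n)
open import Data.Product using (_×_; _,_; proj₁; proj₂; ∃-syntax)
open import Data.Sum using (_⊎_; inj₁; inj₂)
import Data.Sum as Sum
open import Data.Sum.Function.Propositional using (_⊎-⇔_)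
open import Function using (_∘_; const)
open import Function.Bundles using (_⇔_; mk⇔; module Equivalence)
import Function.Properties.Equivalence as ⇔
open import Function.Related.Propositional using (module EquationalReasoning; equivalence)
open import Relation.Binary.PropositionalEquality as ≡ using (_≡_; _≢_; refl; cong; subst)
open import Relation.Nullary using (¬_; yes; no; contradiction)

open Equivalence using (to; from)

module ⇔-Reasoning = EquationalReasoning {k = equivalence}

⊎-middle⇔ : ∀ {P Q R : Set} → ¬ P → ¬ R → (P ⊎ Q ⊎ R) ⇔ Q
⊎-middle⇔ ¬p ¬r = mk⇔ Sum.[ ⊥-elim ∘ ¬p , Sum.[ (λ q → q) , ⊥-elim ∘ ¬r ] ] (inj₂ ∘ inj₁)

Any-[-]⇔ : ∀ {A : Set} {P : A → Set} {x} → Any P [ x ] ⇔ P x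
Any-[-]⇔ = mk⇔ (λ { (here p) → p ; (there ()) }) here

module _ {A : Set} where

  Any-++⇔ : ∀ {P : A → Set} xs {ys} → Any P (xs ++ ys) ⇔ (Any P xs ⊎ Any P ys)
  Any-++⇔ xs = mk⇔ (Any.++⁻ xs) Sum.[ Any.++⁺ˡ , Any.++⁺ʳ xs ]

  Any-++₃⇔ : ∀ {P : A → Set} xs ys zs →
    Any P (xs ++ ys ++ zs) ⇔ (Any P xs ⊎ Any P ys ⊎ Any P zs)
  Any-++₃⇔ xs ys _ = ⇔.trans (Any-++⇔ xs) (⇔.refl ⊎-⇔ Any-++⇔ ys)

  concat-++₃ : ∀ (xss yss zss : List (List A)) →
    concat (xss ++ yss ++ zss) ≡ concat xss ++ concat yss ++ concat zss
  concat-++₃ xss yss zss = begin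
    concat (xss ++ yss ++ zss)              ≡⟨ concat-++ xss (yss ++ zss) ⟨
    concat xss ++ concat (yss ++ zss)       ≡⟨ cong (concat xss ++_) (concat-++ yss zss) ⟨
    concat xss ++ concat yss ++ concat zss  ∎
    where open ≡.≡-Reasoning

  ∈-concat-++₃⇔ : ∀ {x : A} xss yss zss →
    x ∈ concat (xss ++ yss ++ zss) ⇔ (x ∈ concat xss ⊎ x ∈ concat yss ⊎ x ∈ concat zss)
  ∈-concat-++₃⇔ xss yss zss rewrite concat-++₃ xss yss zss = Any-++₃⇔ (concat xss) _ _

  ∈-skip⇔ : ∀ xs {ys} {x v : A} → x ≢ v → x ∈ xs ++ v ∷ ys ⇔ x ∈ xs ++ ys
  ∈-skip⇔ [] x≢v = mk⇔ (λ { (here x≡v) → ⊥-elim (x≢v x≡v) ; (there x∈ys) → x∈ys }) there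
  ∈-skip⇔ (a ∷ xs) x≢v =
    mk⇔ (λ { (here x≡a) → here x≡a ; (there m) → there (to skip m) })
        (λ { (here x≡a) → here x≡a ; (there m) → there (from skip m) })
    where skip = ∈-skip⇔ xs x≢v

  Unique-++⁻ : ∀ xs {ys : List A} → Unique (xs ++ ys) → Unique xs × Unique ys × Disjoint xs ys
  Unique-++⁻ [] u = [] , u , λ { (() , _) }
  Unique-++⁻ (x ∷ xs) (x∉ ∷ u) with Unique-++⁻ xs u | All.++⁻ xs x∉
  ... | uxs , uys , xs#ys | x∉xs , x∉ys =
    x∉xs ∷ uxs , uys ,
    λ { (here refl , y∈ys) → All.lookup x∉ys y∈ys refl ; (there y∈xs , y∈ys) → xs#ys (y∈xs , y∈ys) }

  ∉-++-middle : ∀ xs {ys zs : List A} {x} → Unique (xs ++ ys ++ zs) → x ∈ ys → x ∉ xs × x ∉ zs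
  ∉-++-middle xs {ys} u x∈ys with Unique-++⁻ xs u
  ... | _ , uyzs , xs#yzs =
    (λ x∈xs → xs#yzs (x∈xs , ∈-++⁺ˡ x∈ys)) ,
    (λ x∈zs → proj₂ (proj₂ (Unique-++⁻ ys uyzs)) (x∈ys , x∈zs))

  Unique-++-middle : ∀ xs ys {ys' zs : List A} → Unique (xs ++ ys ++ zs) → Unique ys' →
    (∀ {x} → x ∈ ys' → x ∈ ys ⊎ (x ∉ xs × x ∉ zs)) → Unique (xs ++ ys' ++ zs)
  Unique-++-middle xs ys {ys'} {zs} u u' fresh with Unique-++⁻ xs u
  ... | uxs , uyzs , xs#yzs with Unique-++⁻ ys uyzs
  ... | _ , uzs , ys#zs = Unique.++⁺ uxs (Unique.++⁺ u' uzs ys'#zs) xs#ys'zs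
    where
    ys'#zs : Disjoint ys' zs
    ys'#zs (x∈ys' , x∈zs) with fresh x∈ys'
    ... | inj₁ x∈ys = ys#zs (x∈ys , x∈zs)
    ... | inj₂ (_ , x∉zs) = x∉zs x∈zs
    xs#ys'zs : Disjoint xs (ys' ++ zs)
    xs#ys'zs (x∈xs , x∈ys'zs) with Any.++⁻ ys' x∈ys'zs
    ... | inj₂ x∈zs = xs#yzs (x∈xs , ∈-++⁺ʳ ys x∈zs)
    ... | inj₁ x∈ys' with fresh x∈ys'
    ...   | inj₁ x∈ys = xs#yzs (x∈xs , ∈-++⁺ˡ x∈ys)
    ...   | inj₂ (x∉xs , _) = x∉xs x∈xs

  Unique-concat-∈ : ∀ {xs} {xss : List (List A)} → Unique (concat xss) → xs ∈ xss → Unique xs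
  Unique-concat-∈ {xss = xs ∷ _} u (here refl) = proj₁ (Unique-++⁻ xs u)
  Unique-concat-∈ {xss = ys ∷ _} u (there xs∈xss) =
    Unique-concat-∈ (proj₁ (proj₂ (Unique-++⁻ ys u))) xs∈xss

  length≤1⇒none⊎unique : ∀ {P : A → Set} xs → length xs ≤ 1 → (∀ x → x ∈ xs ⇔ P x) →
    (∀ x → ¬ P x) ⊎ ∃[ w ] (∀ x → P x ⇔ x ≡ w)
  length≤1⇒none⊎unique [] _ mem = inj₁ (λ x → ¬Any[] ∘ from (mem x))
  length≤1⇒none⊎unique (w ∷ []) _ mem = inj₂ (w , λ x → ⇔.trans (⇔.sym (mem x)) Any-[-]⇔)
  length≤1⇒none⊎unique (_ ∷ _ ∷ _) (s≤s ()) _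

  -- Empty vertex sequences are not paths, so they must be dropped.
  nonempty : List A → List (List A)
  nonempty [] = []
  nonempty (x ∷ xs) = [ x ∷ xs ]

  concat-nonempty : ∀ xs → concat (nonempty xs) ≡ xs
  concat-nonempty [] = refl
  concat-nonempty (x ∷ xs) = ++-identityʳ (x ∷ xs)

  Any-nonempty⇔ : ∀ {P : List A → Set} → ¬ P [] → ∀ xs → Any P (nonempty xs) ⇔ P xs
  Any-nonempty⇔ ¬p[] [] = mk⇔ (λ ()) (⊥-elim ∘ ¬p[])
  Any-nonempty⇔ ¬p[] (x ∷ xs) = Any-[-]⇔

module _ {n : ℕ} where

  Consec-sym : ∀ {u z : Fin n} {p} → Consec u z p → Consec z u p
  Consec-sym here-fw = here-bw
  Consec-sym here-bw = here-fw
  Consec-sym (there c) = there (Consec-sym c)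

  Consec-∈ : ∀ {u z : Fin n} {p} → Consec u z p → u ∈ p
  Consec-∈ here-fw = here refl
  Consec-∈ here-bw = there (here refl)
  Consec-∈ (there c) = there (Consec-∈ c)

  Consec-irrefl : ∀ {x : Fin n} {p} → Unique p → ¬ Consec x x p
  Consec-irrefl ((x≢x ∷ _) ∷ _) here-fw = x≢x refl
  Consec-irrefl ((x≢x ∷ _) ∷ _) here-bw = x≢x refl
  Consec-irrefl (_ ∷ u) (there c) = Consec-irrefl u c

  Consec-swap : ∀ {u z a b : Fin n} → Consec u z (a ∷ b ∷ []) → Consec u z (b ∷ a ∷ [])
  Consec-swap here-fw = here-bw
  Consec-swap here-bw = here-fw
  Consec-swap (there (there ()))

  Consec-∷⇔ : ∀ {u z v : Fin n} {p} → u ≢ v → z ≢ v → Consec u z (v ∷ p) ⇔ Consec u z p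
  Consec-∷⇔ u≢v z≢v =
    mk⇔ (λ { here-fw → ⊥-elim (u≢v refl) ; here-bw → ⊥-elim (z≢v refl) ; (there c) → c }) there

  Consec-++-∷⁻ : ∀ xs {ys} {u z v : Fin n} → u ≢ v → z ≢ v →
    Consec u z (xs ++ v ∷ ys) → Consec u z xs ⊎ Consec u z ys
  Consec-++-∷⁻ [] u≢v z≢v c = inj₂ (to (Consec-∷⇔ u≢v z≢v) c)
  Consec-++-∷⁻ (_ ∷ []) u≢v z≢v here-fw = ⊥-elim (z≢v refl)
  Consec-++-∷⁻ (_ ∷ []) u≢v z≢v here-bw = ⊥-elim (u≢v refl)
  Consec-++-∷⁻ (_ ∷ _ ∷ _) _ _ here-fw = inj₁ here-fw
  Consec-++-∷⁻ (_ ∷ _ ∷ _) _ _ here-bw = inj₁ here-bw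
  Consec-++-∷⁻ (_ ∷ xs) u≢v z≢v (there c) = Sum.map₁ there (Consec-++-∷⁻ xs u≢v z≢v c)

  Consec-++-∷⁺ : ∀ xs {ys} {u z v : Fin n} → Consec u z xs ⊎ Consec u z ys → Consec u z (xs ++ v ∷ ys)
  Consec-++-∷⁺ [] (inj₂ c) = there c
  Consec-++-∷⁺ (_ ∷ _ ∷ _) (inj₁ here-fw) = here-fw
  Consec-++-∷⁺ (_ ∷ _ ∷ _) (inj₁ here-bw) = here-bw
  Consec-++-∷⁺ (_ ∷ xs) (inj₁ (there c)) = there (Consec-++-∷⁺ xs (inj₁ c))
  Consec-++-∷⁺ (_ ∷ xs) (inj₂ c) = there (Consec-++-∷⁺ xs (inj₂ c))

  Consec-++-∷⇔ : ∀ xs {ys} {u z v : Fin n} → u ≢ v → z ≢ v →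
    Consec u z (xs ++ v ∷ ys) ⇔ (Consec u z xs ⊎ Consec u z ys)
  Consec-++-∷⇔ xs u≢v z≢v = mk⇔ (Consec-++-∷⁻ xs u≢v z≢v) (Consec-++-∷⁺ xs)

  Consec-head⇔ : ∀ {v w z : Fin n} {p} → v ∉ w ∷ p → z ≢ v → Consec v z (v ∷ w ∷ p) ⇔ z ≡ w
  Consec-head⇔ v∉ z≢v =
    mk⇔ (λ { here-fw → refl ; here-bw → ⊥-elim (z≢v refl) ; (there c) → ⊥-elim (v∉ (Consec-∈ c)) })
        (λ { refl → here-fw })

  Any-Consec-∈ : ∀ {u z : Fin n} {Ps} → Any (Consec u z) Ps → u ∈ concat Ps
  Any-Consec-∈ (here c) = ∈-++⁺ˡ (Consec-∈ c)
  Any-Consec-∈ {Ps = p ∷ _} (there c) = ∈-++⁺ʳ p (Any-Consec-∈ c)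

  Any-Consec-irrefl : ∀ {x : Fin n} {Ps} → Unique (concat Ps) → ¬ Any (Consec x x) Ps
  Any-Consec-irrefl {Ps = p ∷ _} u (here c) = Consec-irrefl (proj₁ (Unique-++⁻ p u)) c
  Any-Consec-irrefl {Ps = p ∷ _} u (there c) = Any-Consec-irrefl (proj₁ (proj₂ (Unique-++⁻ p u))) c

  Any-Consec-sym⇔ : ∀ {u z : Fin n} {Ps} → Any (Consec u z) Ps ⇔ Any (Consec z u) Ps
  Any-Consec-sym⇔ = mk⇔ (Any.map Consec-sym) (Any.map Consec-sym)

  ShortPathSeq-nonempty : ∀ (p : List (Fin n)) → length p ≤ 3 → All ShortPathSeq (nonempty p)
  ShortPathSeq-nonempty [] _ = []
  ShortPathSeq-nonempty (_ ∷ _) len = (s≤s z≤n , len) ∷ []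

  record SamePath (p p' : List (Fin n)) : Set where
    field
      members : ∀ x → x ∈ p ⇔ x ∈ p'
      consec  : ∀ u z → Consec u z p ⇔ Consec u z p'

  SamePath-refl : ∀ {p} → SamePath p p
  SamePath-refl = record { members = λ _ → ⇔.refl ; consec = λ _ _ → ⇔.refl }

  startingAt : ∀ {w} q → Unique q → length q ≤ 2 → w ∈ q →
    ∃[ rest ] (SamePath q (w ∷ rest) × Unique (w ∷ rest) × length rest ≤ 1)
  startingAt (_ ∷ []) u _ (here refl) = [] , SamePath-refl , u , z≤n
  startingAt (_ ∷ x ∷ []) u _ (here refl) = x ∷ [] , SamePath-refl , u , s≤s z≤n
  startingAt (x ∷ _ ∷ []) ((x≢w ∷ []) ∷ _) _ (there (here refl)) =
    x ∷ [] , record { members = λ _ → mk⇔ swap swap ; consec = λ _ _ → mk⇔ Consec-swap Consec-swap } ,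
    ((x≢w ∘ ≡.sym) ∷ []) ∷ [] ∷ [] , s≤s z≤n
    where
    swap : ∀ {y a b : Fin n} → y ∈ a ∷ b ∷ [] → y ∈ b ∷ a ∷ []
    swap (here y≡a) = there (here y≡a)
    swap (there (here y≡b)) = here y≡b
    swap (there (there ()))
  startingAt (_ ∷ _ ∷ _ ∷ _) _ (s≤s (s≤s ())) _

∧-true⇔ : ∀ {a b} → a ∧ b ≡ true ⇔ (a ≡ true × b ≡ true)
∧-true⇔ {true} = mk⇔ (refl ,_) proj₂
∧-true⇔ {false} = mk⇔ (λ ()) (λ { (() , _) })

∈-filterᵇ-allFin⇔ : ∀ {n} (p : Fin n → Bool) x → x ∈ filterᵇ p (allFin n) ⇔ p x ≡ true
∈-filterᵇ-allFin⇔ p x =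
  mk⇔ (λ m → to T-≡ (proj₂ (∈-filter⁻ (T? ∘ p) {xs = allFin _} m)))
      (λ e → ∈-filter⁺ (T? ∘ p) (∈-allFin x) (from T-≡ e))

moveToB-self : ∀ {n} (side : VSet n) v → moveToB side v v ≡ false
moveToB-self side v with v ≟ v
... | yes _ = refl
... | no v≢v = contradiction refl v≢v

moveToB-≢ : ∀ {n} (side : VSet n) {v} x → x ≢ v → moveToB side v x ≡ side x
moveToB-≢ side {v} x x≢v with x ≟ v
... | yes x≡v = contradiction x≡v x≢v
... | no _ = refl

agreeOff-true : ∀ {n} {S S' : VSet n} {v} → (∀ x → x ≢ v → S' x ≡ S x) →
  ∀ x → x ≢ v → S' x ≡ true → S x ≡ true
agreeOff-true S'≗S x x≢v S'x = ≡.trans (≡.sym (S'≗S x x≢v)) S'x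

module _ {n : ℕ} (G : SimpleGraph n) where

  Decomposes : VSet n → List (List (Fin n)) → Set
  Decomposes S Ps =
    All ShortPathSeq Ps
    × Unique (concat Ps)
    × (∀ v → (v ∈ concat Ps) ⇔ (S v ≡ true))
    × (∀ u v → S u ≡ true → S v ≡ true → (adj G u v ≡ true) ⇔ Any (Consec u v) Ps)

  -- Qs can replace the paths Rs of a decomposition once the vertex set changes to S' at v only:
  -- it agrees with Rs away from v, and treats v and its edges as S' requires.
  record Repair (S' : VSet n) (v : Fin n) (Rs Qs : List (List (Fin n))) : Set where
    field
      short    : All ShortPathSeq Qs
      unique   : Unique (concat Qs)
      members  : ∀ x → x ≢ v → x ∈ concat Rs ⇔ x ∈ concat Qs
      consec   : ∀ u z → u ≢ v → z ≢ v → Any (Consec u z) Rs ⇔ Any (Consec u z) Qs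
      member-v : v ∈ concat Qs ⇔ S' v ≡ true
      edges-v  : S' v ≡ true → ∀ z → z ≢ v → S' z ≡ true → (adj G v z ≡ true) ⇔ Any (Consec v z) Qs

  adj-irrefl : ∀ v → adj G v v ≢ true
  adj-irrefl v = not-¬ (irrefl G v)

  adj-sym⇔ : ∀ {u z} → adj G u z ≡ true ⇔ adj G z u ≡ true
  adj-sym⇔ {u} {z} = mk⇔ (≡.trans (sym G z u)) (≡.trans (sym G u z))

  Decomposes-splice : ∀ {S S' v} pre Rs post {Qs} → (∀ x → x ≢ v → S' x ≡ S x) →
    (S v ≡ true → v ∈ concat Rs) → Repair S' v Rs Qs →
    Decomposes S (pre ++ Rs ++ post) → Decomposes S' (pre ++ Qs ++ post)
  Decomposes-splice {S} {S'} {v} pre Rs post {Qs} S'≗S v∈Rs r (short , uniq , mem , edges) =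
    short' , uniq' , mem' , edges'
    where
    module R = Repair r
    open ⇔-Reasoning

    C = concat pre
    D = concat post

    inS : ∀ x → x ≢ v → S' x ≡ true → S x ≡ true
    inS = agreeOff-true S'≗S

    uniq₃ : Unique (C ++ concat Rs ++ D)
    uniq₃ = subst Unique (concat-++₃ pre Rs post) uniq

    v∈S⇒outside : S v ≡ true → v ∉ C × v ∉ D
    v∈S⇒outside = ∉-++-middle C uniq₃ ∘ v∈Rs

    v∉C : v ∉ C
    v∉C v∈C = proj₁ (v∈S⇒outside (to (mem v) (from (∈-concat-++₃⇔ pre Rs post) (inj₁ v∈C)))) v∈C

    v∉D : v ∉ D
    v∉D v∈D = proj₂ (v∈S⇒outside (to (mem v) (from (∈-concat-++₃⇔ pre Rs post) (inj₂ (inj₂ v∈D))))) v∈D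

    short' : All ShortPathSeq (pre ++ Qs ++ post)
    short' = All.++⁺ (All.++⁻ˡ pre short) (All.++⁺ R.short (All.++⁻ʳ Rs (All.++⁻ʳ pre short)))

    uniq' : Unique (concat (pre ++ Qs ++ post))
    uniq' = subst Unique (≡.sym (concat-++₃ pre Qs post))
      (Unique-++-middle C (concat Rs) uniq₃ R.unique fresh)
      where
      fresh : ∀ {x} → x ∈ concat Qs → x ∈ concat Rs ⊎ (x ∉ C × x ∉ D)
      fresh {x} x∈Q with x ≟ v
      ... | yes refl = inj₂ (v∉C , v∉D)
      ... | no x≢v = inj₁ (from (R.members x x≢v) x∈Q)

    mem' : ∀ x → x ∈ concat (pre ++ Qs ++ post) ⇔ S' x ≡ true
    mem' x with x ≟ v
    ... | yes refl = begin
      x ∈ concat (pre ++ Qs ++ post)         ∼⟨ ∈-concat-++₃⇔ pre Qs post ⟩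
      (x ∈ C ⊎ x ∈ concat Qs ⊎ x ∈ D)       ∼⟨ ⊎-middle⇔ v∉C v∉D ⟩
      x ∈ concat Qs                          ∼⟨ R.member-v ⟩
      S' x ≡ true                            ∎
    ... | no x≢v = begin
      x ∈ concat (pre ++ Qs ++ post)         ∼⟨ ∈-concat-++₃⇔ pre Qs post ⟩
      (x ∈ C ⊎ x ∈ concat Qs ⊎ x ∈ D)       ∼⟨ ⇔.refl ⊎-⇔ ⇔.sym (R.members x x≢v) ⊎-⇔ ⇔.refl ⟩
      (x ∈ C ⊎ x ∈ concat Rs ⊎ x ∈ D)       ∼⟨ ⇔.sym (∈-concat-++₃⇔ pre Rs post) ⟩
      x ∈ concat (pre ++ Rs ++ post)         ∼⟨ mem x ⟩
      S x ≡ true                             ≡⟨ cong (_≡ true) (S'≗S x x≢v) ⟨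
      S' x ≡ true                            ∎

    edges-at-v : ∀ z → z ≢ v → S' z ≡ true → S' v ≡ true →
      (adj G v z ≡ true) ⇔ Any (Consec v z) (pre ++ Qs ++ post)
    edges-at-v z z≢v S'z S'v = begin
      adj G v z ≡ true
        ∼⟨ R.edges-v S'v z z≢v S'z ⟩
      Any (Consec v z) Qs
        ∼⟨ ⇔.sym (⊎-middle⇔ (v∉C ∘ Any-Consec-∈) (v∉D ∘ Any-Consec-∈)) ⟩
      (Any (Consec v z) pre ⊎ Any (Consec v z) Qs ⊎ Any (Consec v z) post)
        ∼⟨ ⇔.sym (Any-++₃⇔ pre Qs post) ⟩
      Any (Consec v z) (pre ++ Qs ++ post)
        ∎

    edges' : ∀ u z → S' u ≡ true → S' z ≡ true →
      (adj G u z ≡ true) ⇔ Any (Consec u z) (pre ++ Qs ++ post)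
    edges' u z S'u S'z with u ≟ v | z ≟ v
    ... | yes refl | yes refl = mk⇔ (⊥-elim ∘ adj-irrefl u) (⊥-elim ∘ Any-Consec-irrefl uniq')
    ... | yes refl | no z≢v = edges-at-v z z≢v S'z S'u
    ... | no u≢v | yes refl = ⇔.trans adj-sym⇔ (⇔.trans (edges-at-v u u≢v S'u S'z) Any-Consec-sym⇔)
    ... | no u≢v | no z≢v = begin
      adj G u z ≡ true
        ∼⟨ edges u z (inS u u≢v S'u) (inS z z≢v S'z) ⟩
      Any (Consec u z) (pre ++ Rs ++ post)
        ∼⟨ Any-++₃⇔ pre Rs post ⟩
      (Any (Consec u z) pre ⊎ Any (Consec u z) Rs ⊎ Any (Consec u z) post)
        ∼⟨ ⇔.refl ⊎-⇔ R.consec u z u≢v z≢v ⊎-⇔ ⇔.refl ⟩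
      (Any (Consec u z) pre ⊎ Any (Consec u z) Qs ⊎ Any (Consec u z) post)
        ∼⟨ ⇔.sym (Any-++₃⇔ pre Qs post) ⟩
      Any (Consec u z) (pre ++ Qs ++ post)
        ∎

  Repair-delete : ∀ {S' v} xs {ys} → S' v ≡ false → Unique (xs ++ v ∷ ys) → length (xs ++ v ∷ ys) ≤ 3 →
    Repair S' v [ xs ++ v ∷ ys ] (nonempty xs ++ nonempty ys)
  Repair-delete {v = v} xs {ys} S'v uniq len = record
    { short    = All.++⁺ (ShortPathSeq-nonempty xs len-xs) (ShortPathSeq-nonempty ys len-ys)
    ; unique   = subst Unique (≡.sym concat-pieces) unique-xs++ys
    ; members  = λ x x≢v → begin
        x ∈ concat [ xs ++ v ∷ ys ]            ≡⟨ cong (x ∈_) (++-identityʳ (xs ++ v ∷ ys)) ⟩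
        x ∈ xs ++ v ∷ ys                       ∼⟨ ∈-skip⇔ xs x≢v ⟩
        x ∈ xs ++ ys                           ≡⟨ cong (x ∈_) concat-pieces ⟨
        x ∈ concat (nonempty xs ++ nonempty ys) ∎
    ; consec   = λ u z u≢v z≢v → begin
        Any (Consec u z) [ xs ++ v ∷ ys ]                          ∼⟨ Any-[-]⇔ ⟩
        Consec u z (xs ++ v ∷ ys)                                  ∼⟨ Consec-++-∷⇔ xs u≢v z≢v ⟩
        (Consec u z xs ⊎ Consec u z ys)                            ∼⟨ ⇔.sym (piece xs ⊎-⇔ piece ys) ⟩
        (Any (Consec u z) (nonempty xs) ⊎ Any (Consec u z) (nonempty ys))
                                                                   ∼⟨ ⇔.sym (Any-++⇔ (nonempty xs)) ⟩
        Any (Consec u z) (nonempty xs ++ nonempty ys)              ∎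
    ; member-v = mk⇔ (⊥-elim ∘ v∉xs++ys ∘ subst (v ∈_) concat-pieces) (⊥-elim ∘ not-¬ S'v)
    ; edges-v  = ⊥-elim ∘ not-¬ S'v
    }
    where
    open ⇔-Reasoning

    concat-pieces : concat (nonempty xs ++ nonempty ys) ≡ xs ++ ys
    concat-pieces = ≡.trans (≡.sym (concat-++ (nonempty xs) (nonempty ys)))
                            (≡.cong₂ _++_ (concat-nonempty xs) (concat-nonempty ys))

    piece : ∀ {u z} zs → Any (Consec u z) (nonempty zs) ⇔ Consec u z zs
    piece = Any-nonempty⇔ λ ()

    total : length xs + length (v ∷ ys) ≤ 3
    total = ≤-trans (≤-reflexive (≡.sym (length-++ xs))) len
    len-xs : length xs ≤ 3
    len-xs = ≤-trans (m≤m+n (length xs) _) total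
    len-ys : length ys ≤ 3
    len-ys = ≤-trans (≤-trans (n≤1+n (length ys)) (m≤n+m _ (length xs))) total

    unique-xs++ys : Unique (xs ++ ys)
    unique-xs++ys with Unique-++⁻ xs uniq
    ... | uxs , _ ∷ uys , xs#vys = Unique.++⁺ uxs uys (λ (x∈xs , x∈ys) → xs#vys (x∈xs , there x∈ys))

    v∉xs++ys : v ∉ xs ++ ys
    v∉xs++ys v∈ with Unique-++⁻ xs uniq | Any.++⁻ xs v∈
    ... | _ , _ , xs#vys | inj₁ v∈xs = xs#vys (v∈xs , here refl)
    ... | _ , v∉ys ∷ _ , _ | inj₂ v∈ys = All.lookup v∉ys v∈ys refl

  Repair-isolated : ∀ {S' v} → S' v ≡ true → (∀ z → z ≢ v → S' z ≡ true → adj G v z ≢ true) →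
    Repair S' v [] [ [ v ] ]
  Repair-isolated S'v isolated = record
    { short    = (s≤s z≤n , s≤s z≤n) ∷ []
    ; unique   = [] ∷ []
    ; members  = λ x x≢v → mk⇔ (λ ()) (λ { (here x≡v) → ⊥-elim (x≢v x≡v) ; (there ()) })
    ; consec   = λ _ _ _ _ → mk⇔ (λ ()) (λ { (here (there ())) ; (there ()) })
    ; member-v = mk⇔ (const S'v) (const (here refl))
    ; edges-v  = λ _ z z≢v S'z → mk⇔ (⊥-elim ∘ isolated z z≢v S'z) (λ { (here (there ())) ; (there ()) })
    }

  Repair-extend : ∀ {S' v w rest} q → SamePath q (w ∷ rest) → Unique (w ∷ rest) → length rest ≤ 1 →
    v ∉ q → S' v ≡ true → (∀ z → z ≢ v → S' z ≡ true → (adj G v z ≡ true) ⇔ z ≡ w) →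
    Repair S' v [ q ] [ v ∷ w ∷ rest ]
  Repair-extend {v = v} {w} {rest} q same uniq len v∉q S'v neighbour = record
    { short    = (s≤s z≤n , s≤s (s≤s len)) ∷ []
    ; unique   = subst Unique (≡.sym (++-identityʳ (v ∷ w ∷ rest))) (¬Any⇒All¬ _ v∉w∷rest ∷ uniq)
    ; members  = λ x x≢v → begin
        x ∈ concat [ q ]                 ≡⟨ cong (x ∈_) (++-identityʳ q) ⟩
        x ∈ q                            ∼⟨ SamePath.members same x ⟩
        x ∈ w ∷ rest                     ∼⟨ ⇔.sym (∈-skip⇔ [] x≢v) ⟩
        x ∈ v ∷ w ∷ rest                 ≡⟨ cong (x ∈_) (++-identityʳ (v ∷ w ∷ rest)) ⟨
        x ∈ concat [ v ∷ w ∷ rest ]      ∎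
    ; consec   = λ u z u≢v z≢v → begin
        Any (Consec u z) [ q ]              ∼⟨ Any-[-]⇔ ⟩
        Consec u z q                        ∼⟨ SamePath.consec same u z ⟩
        Consec u z (w ∷ rest)               ∼⟨ ⇔.sym (Consec-∷⇔ u≢v z≢v) ⟩
        Consec u z (v ∷ w ∷ rest)           ∼⟨ ⇔.sym Any-[-]⇔ ⟩
        Any (Consec u z) [ v ∷ w ∷ rest ]   ∎
    ; member-v = mk⇔ (const S'v) (const (here refl))
    ; edges-v  = λ _ z z≢v S'z → begin
        adj G v z ≡ true                    ∼⟨ neighbour z z≢v S'z ⟩
        z ≡ w                               ∼⟨ ⇔.sym (Consec-head⇔ v∉w∷rest z≢v) ⟩
        Consec v z (v ∷ w ∷ rest)           ∼⟨ ⇔.sym Any-[-]⇔ ⟩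
        Any (Consec v z) [ v ∷ w ∷ rest ]   ∎
    }
    where
    open ⇔-Reasoning

    v∉w∷rest : v ∉ w ∷ rest
    v∉w∷rest = v∉q ∘ from (SamePath.members same v)

  path-length≤2 : ∀ {S Ps q} → Decomposes S Ps → ComponentsAtMostOneEdge G S → q ∈ Ps → length q ≤ 2
  path-length≤2 {q = []} _ _ _ = z≤n
  path-length≤2 {q = _ ∷ []} _ _ _ = s≤s z≤n
  path-length≤2 {q = _ ∷ _ ∷ []} _ _ _ = s≤s (s≤s z≤n)
  path-length≤2 {q = _ ∷ _ ∷ _ ∷ _ ∷ _} (short , _) _ q∈Ps with All.lookup short q∈Ps
  ... | _ , s≤s (s≤s (s≤s ()))
  path-length≤2 {S} {q = a ∷ b ∷ c ∷ []} (_ , uniq , mem , edges) one-edge q∈Ps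
    with one-edge a b b c (onPath (here refl)) (onPath b∈q) (onPath b∈q) (onPath (there (there (here refl))))
                  (edge here-fw) (edge (there here-fw)) (step (edge here-fw) (onPath b∈q) refl-r)
       | head-distinct (Unique-concat-∈ uniq q∈Ps)
    where
    b∈q : b ∈ a ∷ b ∷ c ∷ []
    b∈q = there (here refl)

    onPath : ∀ {x} → x ∈ a ∷ b ∷ c ∷ [] → S x ≡ true
    onPath x∈q = to (mem _) (∈-concat⁺′ x∈q q∈Ps)

    edge : ∀ {u z} → Consec u z (a ∷ b ∷ c ∷ []) → adj G u z ≡ true
    edge uz = from (edges _ _ (onPath (Consec-∈ uz)) (onPath (Consec-∈ (Consec-sym uz)))) (lose q∈Ps uz)

    head-distinct : Unique (a ∷ b ∷ c ∷ []) → a ≢ b × a ≢ c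
    head-distinct ((a≢b ∷ a≢c ∷ []) ∷ _) = a≢b , a≢c
  ... | inj₁ (a≡b , _) | a≢b , _ = ⊥-elim (a≢b a≡b)
  ... | inj₂ (a≡c , _) | _ , a≢c = ⊥-elim (a≢c a≡c)

  neighboursIn≤1 : ∀ {S v} → neighboursIn G S v ≤ 1 →
    (∀ z → S z ≡ true → adj G v z ≢ true) ⊎
    ∃[ w ] (S w ≡ true × (∀ z → S z ≡ true → (adj G v z ≡ true) ⇔ z ≡ w))
  neighboursIn≤1 {S} {v} few
    with length≤1⇒none⊎unique _ few (∈-filterᵇ-allFin⇔ (λ u → adj G v u ∧ S u))
  ... | inj₁ none = inj₁ (λ z Sz e → none z (from ∧-true⇔ (e , Sz)))
  ... | inj₂ (w , only-w) =
    inj₂ (w , proj₂ (to ∧-true⇔ (from (only-w w) refl)) ,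
          λ z Sz → mk⇔ (λ e → to (only-w z) (from ∧-true⇔ (e , Sz)))
                       (λ { refl → proj₁ (to ∧-true⇔ (from (only-w w) refl)) }))

  DisjointUnionShortPaths-delete : ∀ {S S' v} → (∀ x → x ≢ v → S' x ≡ S x) → S v ≡ true → S' v ≡ false →
    DisjointUnionShortPaths G S → DisjointUnionShortPaths G S'
  DisjointUnionShortPaths-delete {v = v} S'≗S Sv S'v (Ps , dec@(short , uniq , mem , _))
    with q , v∈q , q∈Ps ← ∈-concat⁻′ Ps (from (mem v) Sv)
    with pre , post , refl ← ∈-∃++ q∈Ps
    with xs , ys , refl ← ∈-∃++ v∈q
    = _ , Decomposes-splice pre [ q ] post S'≗S (const (∈-++⁺ˡ v∈q))
            (Repair-delete xs S'v (Unique-concat-∈ uniq q∈Ps) (proj₂ (All.lookup short q∈Ps))) dec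

  DisjointUnionShortPaths-attach : ∀ {S S' v} → (∀ x → x ≢ v → S' x ≡ S x) → S v ≡ false → S' v ≡ true →
    ComponentsAtMostOneEdge G S → neighboursIn G S v ≤ 1 →
    DisjointUnionShortPaths G S → DisjointUnionShortPaths G S'
  DisjointUnionShortPaths-attach {v = v} S'≗S Sv S'v one-edge few (Ps , dec@(_ , uniq , mem , _))
    with neighboursIn≤1 few
  ... | inj₁ none =
    _ , Decomposes-splice [] [] Ps S'≗S (⊥-elim ∘ not-¬ Sv)
          (Repair-isolated S'v (λ z z≢v S'z → none z (agreeOff-true S'≗S z z≢v S'z))) dec
  ... | inj₂ (w , Sw , only-w)
    with q , w∈q , q∈Ps ← ∈-concat⁻′ Ps (from (mem w) Sw)
    with rest , same , uniq-w∷rest , len ← startingAt q (Unique-concat-∈ uniq q∈Ps)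
                                                     (path-length≤2 dec one-edge q∈Ps) w∈q
    with pre , post , refl ← ∈-∃++ q∈Ps
    = _ , Decomposes-splice pre [ q ] post S'≗S (⊥-elim ∘ not-¬ Sv)
            (Repair-extend q same uniq-w∷rest len (λ v∈q → not-¬ Sv (to (mem v) (∈-concat⁺′ v∈q q∈Ps))) S'v
              (λ z z≢v S'z → only-w z (agreeOff-true S'≗S z z≢v S'z))) dec

lemma8 : ∀ {n} (G : SimpleGraph n) (side : VSet n) →
    MaxDegreeAtMost G 3 →
    Nice G side →
    ComponentsAtMostOneEdge G (inB side) →
    (v : Fin n) → side v ≡ true →
    neighboursIn G (inB side) v ≤ 1 →
    Nice G (moveToB side v)
lemma8 G side _ (niceA , niceB) one-edge v v∈A few =
    DisjointUnionShortPaths-delete G (moveToB-≢ side) v∈A (moveToB-self side v) niceA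
  , DisjointUnionShortPaths-attach G (λ x x≢v → cong not (moveToB-≢ side x x≢v)) (cong not v∈A)
      (cong not (moveToB-self side v)) one-edge few niceB
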